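{- Let $C$ be a $d$-dimensional smooth combinatorial cube in $\mathbb{R}^d$ with $d\geq 3$, and let $x,y,z\in[d]$ be distinct. Suppose that $F_{xz}$ is parallel to $F_{x\bar z}$ and $F_{yz}$ is parallel to $F_{y\bar z}$. Then $F_z$ is parallel to $F_{\bar z}$.
   Context: A $d$-dimensional combinatorial cube $C$ is a polytope whose face poset is isomorphic to that of $[0,1]^d$; fix such an isomorphism. For disjoint $I,J\subseteq[d]=\{1,\dots,d\}$, $F_I^J$ denotes the face of $C$ corresponding to the face $\{x\in[0,1]^d : x_k=0 \text{ for } k\in I,\ x_k=1\text{ for }k\in J\}$ of the unit cube. Shorthand: indices in $I$ are written plainly and indices in $J$ with a bar, e.g. $F_{x\bar z}=F_{\{x\}}^{\{z\}}$, $F_{xz}=F_{\{x,z\}}^{\emptyset}$, $F_z=F_{\{z\}}^{\emptyset}$, $F_{\bar z}=F_{\emptyset}^{\{z\}}$. A $d$-dimensional polytope in $\mathbb{R}^d$ is smooth if it is a lattice polytope, each vertex lies on exactly $d$ edges, and the primitive edge directions at each vertex form a basis of $\mathbb{Z}^d$. Faces $F,G$ are parallel if the linear subspaces parallel to their affine hulls coincide. -}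

module Defs where

open import Data.Nat using (ℕ; zero; suc)
open import Data.Fin using (Fin; zero; suc)
open import Data.Bool using (Bool; true; false)
open import Data.Maybe using (Maybe; just; nothing)
open import Data.List using (List; []; _∷_)
open import Data.Product using (Σ; ∃; _×_; _,_)
open import Data.Sum using (_⊎_)
open import Data.Integer as ℤ using (ℤ; +_; -[1+_])
open import Data.Rational as ℚ using (ℚ; _/_; 0ℚ)
open import Function using (_∘_; _⇔_)
open import Relation.Binary.PropositionalEquality using (_≡_)
open import Relation.Nullary using (¬_)

ℤ^ : ℕ → Set
ℤ^ d = Fin d → ℤ

ℚ^ : ℕ → Set
ℚ^ d = Fin d → ℚ

toℚ : ℤ → ℚ
toℚ z = z / 1

sumℤ : ∀ {n} → (Fin n → ℤ) → ℤ
sumℤ {zero}  f = + 0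
sumℤ {suc n} f = f zero ℤ.+ sumℤ (f ∘ suc)

sumℚ : ∀ {n} → (Fin n → ℚ) → ℚ
sumℚ {zero}  f = 0ℚ
sumℚ {suc n} f = f zero ℚ.+ sumℚ (f ∘ suc)

eval : ∀ {d} → ℚ^ d → ℤ^ d → ℚ
eval c p = sumℚ (λ i → c i ℚ.* toℚ (p i))

-- Vertices of the unit cube [0,1]^d are labelled by Fin d → Bool
-- (false = coordinate 0, true = coordinate 1).
-- A face F_I^J of the unit cube is encoded by σ : Fin d → Maybe Bool:
--   σ k = just false  ⇔ k ∈ I  (x_k = 0)
--   σ k = just true   ⇔ k ∈ J  (x_k = 1)
--   σ k = nothing     ⇔ k ∉ I ∪ J  (free coordinate)
-- (this encodes exactly the disjoint pairs I, J).

Label : ℕ → Set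
Label d = Fin d → Bool

CubeFace : ℕ → Set
CubeFace d = Fin d → Maybe Bool

_∈CF_ : ∀ {d} → Label d → CubeFace d → Set
b ∈CF σ = ∀ k {v} → σ k ≡ just v → b k ≡ v

-- A lattice polytope P = conv (image φ) in ℝ^d whose vertices are
-- labelled by φ : Label d → ℤ^d.  A (nonempty) face of P is the set of
-- vertices maximising a linear functional c; it is recorded by the set
-- of labels of its vertices.

MaxFace : ∀ {d} → (Label d → ℤ^ d) → ℚ^ d → Label d → Set
MaxFace φ c b = ∀ b' → eval c (φ b') ℚ.≤ eval c (φ b)

Exposes : ∀ {d} → (Label d → ℤ^ d) → ℚ^ d → CubeFace d → Set
Exposes φ c σ = ∀ b → (b ∈CF σ ⇔ MaxFace φ c b)

-- C = conv(image φ) is a combinatorial cube, with the face-poset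
-- isomorphism to [0,1]^d fixed by the labelling φ of its vertices:
-- φ is injective, the image of every face of the unit cube is (the
-- vertex set of) a face of C, and every nonempty face of C is of this form.
IsCombinatorialCube : ∀ {d} → (Label d → ℤ^ d) → Set
IsCombinatorialCube {d} φ =
  (∀ b b' → (∀ i → φ b i ≡ φ b' i) → ∀ k → b k ≡ b' k)
  × (∀ (σ : CubeFace d) → ∃ λ c → Exposes φ c σ)
  × (∀ (c : ℚ^ d) → ∃ λ σ → Exposes φ c σ)

Edge : ∀ {d} → (Label d → ℤ^ d) → Label d → Label d → Set
Edge φ b b' =
  ¬ (∀ k → b k ≡ b' k)
  × ∃ λ c → ∀ b'' → (MaxFace φ c b'' ⇔ ((∀ k → b'' k ≡ b k) ⊎ (∀ k → b'' k ≡ b' k)))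

PrimitiveDir : ∀ {d} → ℤ^ d → ℤ^ d → Set
PrimitiveDir w u =
  (∃ λ (m : ℕ) → ∀ i → w i ≡ (+ suc m) ℤ.* u i)
  × (∀ (m : ℤ) (v : ℤ^ _) → (∀ i → u i ≡ m ℤ.* v i) → (m ≡ + 1) ⊎ (m ≡ -[1+ 0 ]))

combℤ : ∀ {n d} → (Fin n → ℤ) → (Fin n → ℤ^ d) → ℤ^ d
combℤ a u j = sumℤ (λ i → a i ℤ.* u i j)

IsLatticeBasis : ∀ {d} → (Fin d → ℤ^ d) → Set
IsLatticeBasis {d} u =
  (∀ (z : ℤ^ d) → ∃ λ (a : Fin d → ℤ) → ∀ j → combℤ a u j ≡ z j)
  × (∀ (a a' : Fin d → ℤ) → (∀ j → combℤ a u j ≡ combℤ a' u j) → ∀ i → a i ≡ a' i)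

_-ᵥ_ : ∀ {d} → ℤ^ d → ℤ^ d → ℤ^ d
(p -ᵥ q) i = p i ℤ.- q i

-- Smooth: each vertex lies on exactly d edges (enumerated injectively
-- by e : Fin d → Label d), and the primitive edge directions form a
-- basis of ℤ^d.  (Lattice: vertices are in ℤ^d by construction.)
IsSmooth : ∀ {d} → (Label d → ℤ^ d) → Set
IsSmooth {d} φ = ∀ (b : Label d) →
  Σ (Fin d → Label d) λ e →
    (∀ i j → (∀ k → e i k ≡ e j k) → i ≡ j)
    × (∀ i → Edge φ b (e i))
    × (∀ b' → Edge φ b b' → ∃ λ i → ∀ k → e i k ≡ b' k)
    × Σ (Fin d → ℤ^ d) λ u →
        (∀ i → PrimitiveDir (φ (e i) -ᵥ φ b) (u i))
        × IsLatticeBasis u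

-- The linear space parallel to aff(F) (F with vertex labels σ) is the
-- span of the differences φ b - φ b' with b, b' ∈ σ.  Since these are
-- rational vectors, membership of a rational vector in their real span
-- is the same as in their rational span, given by finite combinations.

record Term (d : ℕ) : Set where
  constructor term
  field
    coeff : ℚ
    plus  : Label d
    minus : Label d

InSpanDiffs : ∀ {d} → (Label d → ℤ^ d) → CubeFace d → ℚ^ d → Set
InSpanDiffs {d} φ σ w =
  Σ (List (Term d)) λ ts →
    AllIn ts × (∀ j → w j ≡ lin ts j)
  where
  AllIn : List (Term d) → Set
  AllIn [] = Data.Unit.⊤ where import Data.Unit
  AllIn (term _ p m ∷ ts) = (p ∈CF σ) × (m ∈CF σ) × AllIn ts
  lin : List (Term d) → ℚ^ d
  lin [] j = 0ℚ
  lin (term q p m ∷ ts) j = q ℚ.* toℚ (φ p j ℤ.- φ m j) ℚ.+ lin ts j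

Parallel : ∀ {d} → (Label d → ℤ^ d) → CubeFace d → CubeFace d → Set
Parallel φ σ τ =
  (∀ b b' → b ∈CF σ → b' ∈CF σ → InSpanDiffs φ τ (λ j → toℚ (φ b j ℤ.- φ b' j)))
  × (∀ b b' → b ∈CF τ → b' ∈CF τ → InSpanDiffs φ σ (λ j → toℚ (φ b j ℤ.- φ b' j)))

-- The cube faces F_{xz}, F_{x z̄}, F_z, etc.
-- face0 k = F_k (x_k = 0), face1 k = F_{k̄} (x_k = 1);
-- face00 x z = F_{xz}, face01 x z = F_{x z̄}.

open import Data.Fin using (_≟_)
open import Relation.Nullary using (yes; no)

face0 : ∀ {d} → Fin d → CubeFace d
face0 k i with i ≟ k
... | yes _ = just false
... | no _  = nothing

face1 : ∀ {d} → Fin d → CubeFace d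
face1 k i with i ≟ k
... | yes _ = just true
... | no _  = nothing

face0v : ∀ {d} → Fin d → Fin d → Bool → CubeFace d
face0v x z v i with i ≟ z
... | yes _ = just v
... | no _ with i ≟ x
...   | yes _ = just false
...   | no _  = nothing

face00 face01 : ∀ {d} → Fin d → Fin d → CubeFace d
face00 x z = face0v x z false
face01 x z = face0v x z true

-- Let σ be the facet x_z = s and τ the opposite facet, and let v be the vertex of σ with all
-- other coordinates 0. At v exactly one edge leaves σ, so when φ b − φ v (b ∈ σ) is expanded in the
-- lattice basis of primitive edge directions at v, the functional exposing σ forces the coefficient
-- of the leaving edge to vanish. Every other edge of v flips a single coordinate other than z, so it
-- fixes x or y, and then it lies in the ridge F_x or F_y of σ; by hypothesis that ridge is parallel to
-- the corresponding ridge of τ. Hence all directions of σ lie in those of τ, and symmetrically.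

module Submission where

open import Defs
open import Data.Nat using (ℕ; _≥_; zero; suc)
open import Data.Fin using (Fin; zero; suc; _≟_; punchIn)
open import Relation.Binary.PropositionalEquality using (_≢_)

open import Algebra.Bundles using (CommutativeMonoid; CommutativeRing)
open import Data.Bool using (Bool; true; false; not)
open import Data.Bool.Properties using (not-¬; ¬-not) renaming (_≟_ to _≟ᵇ_)
import Data.Fin.Properties as FinP
open import Data.Integer as ℤ using (ℤ; +_)
import Data.Integer.Properties as ℤP
open import Data.Integer.Tactic.RingSolver using (solve-∀)
open import Data.Maybe using (just)
open import Data.List using (List; []; _∷_; _++_; map)
open import Data.Product using (Σ; _×_; _,_; proj₁; proj₂)
open import Data.Rational as ℚ using (ℚ; 0ℚ; toℚᵘ)
import Data.Rational.Properties as ℚP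
open import Data.Rational.Unnormalised using (mkℚᵘ; *≡*; _≃_)
import Data.Rational.Unnormalised as ℚᵘ
import Data.Rational.Unnormalised.Properties as ℚᵘP
open import Data.Sum using (_⊎_; inj₁; inj₂; [_,_]′)
open import Data.Unit using (⊤; tt)
open import Data.Vec.Functional.Properties using (updateAt-updates; updateAt-minimal)
open import Data.Vec.Functional using (updateAt)
open import Function using (_∘_; _⇔_; mk⇔; Equivalence)
open import Relation.Nullary using (¬_; Dec; yes; no)
open import Relation.Nullary.Decidable using (map′)
open import Relation.Nullary.Negation using (contradiction)
open import Relation.Binary.PropositionalEquality
  using (_≡_; refl; sym; trans; cong; cong₂; subst; module ≡-Reasoning)

open import Algebra.Properties.Semiring.Sum (CommutativeRing.semiring ℚP.+-*-commutativeRing)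
  using (sum; sum-cong-≗; ∑-distrib-+; ∑-comm; *-distribˡ-sum; sum-remove; sum-replicate-zero)
open import Algebra.Properties.Ring ℚP.+-*-ring using (-1*x≈-x)
open import Algebra.Properties.Group ℚP.+-0-group using (x∙y⁻¹≈ε⇒x≈y; x≈y⇒x∙y⁻¹≈ε)
open import Algebra.Properties.CommutativeSemigroup
  (CommutativeMonoid.commutativeSemigroup ℚP.*-1-commutativeMonoid) using (x∙yz≈y∙xz)

open Equivalence

x*y≡0⇒y≡0 : ∀ {x y} → x ≢ 0ℚ → x ℚ.* y ≡ 0ℚ → y ≡ 0ℚ
x*y≡0⇒y≡0 {x} {y} x≢0 xy≡0 = begin
  y                        ≡⟨ ℚP.*-identityˡ y ⟨
  ℚ.1ℚ ℚ.* y               ≡⟨ cong (ℚ._* y) (ℚP.*-inverseˡ x) ⟨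
  ℚ.1/ x ℚ.* x ℚ.* y       ≡⟨ ℚP.*-assoc (ℚ.1/ x) x y ⟩
  ℚ.1/ x ℚ.* (x ℚ.* y)     ≡⟨ cong (ℚ.1/ x ℚ.*_) xy≡0 ⟩
  ℚ.1/ x ℚ.* 0ℚ            ≡⟨ ℚP.*-zeroʳ (ℚ.1/ x) ⟩
  0ℚ                       ∎
  where
  open ≡-Reasoning
  instance
    x-nonZero : ℚ.NonZero x
    x-nonZero = ℚ.≢-nonZero x≢0

*-1/-cancel : ∀ x y z .{{_ : ℚ.NonZero y}} → x ℚ.* ℚ.1/ y ℚ.* (y ℚ.* z) ≡ x ℚ.* z
*-1/-cancel x y z = begin
  x ℚ.* ℚ.1/ y ℚ.* (y ℚ.* z)    ≡⟨ ℚP.*-assoc x (ℚ.1/ y) (y ℚ.* z) ⟩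
  x ℚ.* (ℚ.1/ y ℚ.* (y ℚ.* z))  ≡⟨ cong (x ℚ.*_) (ℚP.*-assoc (ℚ.1/ y) y z) ⟨
  x ℚ.* (ℚ.1/ y ℚ.* y ℚ.* z)    ≡⟨ cong (λ t → x ℚ.* (t ℚ.* z)) (ℚP.*-inverseˡ y) ⟩
  x ℚ.* (ℚ.1ℚ ℚ.* z)            ≡⟨ cong (x ℚ.*_) (ℚP.*-identityˡ z) ⟩
  x ℚ.* z                       ∎
  where open ≡-Reasoning

toℚᵘ-toℚ : ∀ a → toℚᵘ (toℚ a) ≃ mkℚᵘ a 0
toℚᵘ-toℚ a = ℚP.toℚᵘ-fromℚᵘ (mkℚᵘ a 0)

-- toℚ a normalises the unnormalised fraction a/1, so its algebra is computed in ℚᵘ.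
toℚ-≃ : ∀ {a p} → mkℚᵘ a 0 ≃ toℚᵘ p → toℚ a ≡ p
toℚ-≃ {a} eq = ℚP.toℚᵘ-injective (ℚᵘP.≃-trans (toℚᵘ-toℚ a) eq)

toℚ-+ : ∀ a b → toℚ (a ℤ.+ b) ≡ toℚ a ℚ.+ toℚ b
toℚ-+ a b = toℚ-≃ (begin
  mkℚᵘ (a ℤ.+ b) 0                  ≈⟨ *≡* (cong (ℤ._* ℤ.1ℤ) (sym (cong₂ ℤ._+_ (ℤP.*-identityʳ a) (ℤP.*-identityʳ b)))) ⟩
  mkℚᵘ a 0 ℚᵘ.+ mkℚᵘ b 0           ≈⟨ ℚᵘP.+-cong (ℚᵘP.≃-sym (toℚᵘ-toℚ a)) (ℚᵘP.≃-sym (toℚᵘ-toℚ b)) ⟩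
  toℚᵘ (toℚ a) ℚᵘ.+ toℚᵘ (toℚ b)   ≈⟨ ℚᵘP.≃-sym (ℚP.toℚᵘ-homo-+ (toℚ a) (toℚ b)) ⟩
  toℚᵘ (toℚ a ℚ.+ toℚ b)           ∎)
  where open ℚᵘP.≃-Reasoning

toℚ-* : ∀ a b → toℚ (a ℤ.* b) ≡ toℚ a ℚ.* toℚ b
toℚ-* a b = toℚ-≃ (begin
  mkℚᵘ a 0 ℚᵘ.* mkℚᵘ b 0           ≈⟨ ℚᵘP.*-cong (ℚᵘP.≃-sym (toℚᵘ-toℚ a)) (ℚᵘP.≃-sym (toℚᵘ-toℚ b)) ⟩
  toℚᵘ (toℚ a) ℚᵘ.* toℚᵘ (toℚ b)   ≈⟨ ℚᵘP.≃-sym (ℚP.toℚᵘ-homo-* (toℚ a) (toℚ b)) ⟩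
  toℚᵘ (toℚ a ℚ.* toℚ b)           ∎)
  where open ℚᵘP.≃-Reasoning

toℚ-neg : ∀ a → toℚ (ℤ.- a) ≡ ℚ.- toℚ a
toℚ-neg a = toℚ-≃ (begin
  ℚᵘ.- mkℚᵘ a 0        ≈⟨ ℚᵘP.-‿cong (ℚᵘP.≃-sym (toℚᵘ-toℚ a)) ⟩
  ℚᵘ.- toℚᵘ (toℚ a)    ≈⟨ ℚᵘP.≃-sym (ℚP.toℚᵘ-homo‿- (toℚ a)) ⟩
  toℚᵘ (ℚ.- toℚ a)     ∎)
  where open ℚᵘP.≃-Reasoning

toℚ-- : ∀ a b → toℚ (a ℤ.- b) ≡ toℚ a ℚ.- toℚ b
toℚ-- a b = trans (toℚ-+ a (ℤ.- b)) (cong (toℚ a ℚ.+_) (toℚ-neg b))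

toℚ-suc≢0 : ∀ n → toℚ (+ suc n) ≢ 0ℚ
toℚ-suc≢0 n eq with ℚᵘP.≃-trans (ℚᵘP.≃-sym (toℚᵘ-toℚ (+ suc n))) (ℚP.toℚᵘ-cong eq)
... | *≡* ()

toℚ-sumℤ : ∀ {n} (f : Fin n → ℤ) → toℚ (sumℤ f) ≡ sum (toℚ ∘ f)
toℚ-sumℤ {zero}  f = refl
toℚ-sumℤ {suc n} f = trans (toℚ-+ (f zero) _) (cong (toℚ (f zero) ℚ.+_) (toℚ-sumℤ (f ∘ suc)))

sumℚ≡sum : ∀ {n} (f : Fin n → ℚ) → sumℚ f ≡ sum f
sumℚ≡sum {zero}  f = refl
sumℚ≡sum {suc n} f = cong (f zero ℚ.+_) (sumℚ≡sum (f ∘ suc))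

sum-neg : ∀ {n} (f : Fin n → ℚ) → sum (λ i → ℚ.- f i) ≡ ℚ.- sum f
sum-neg {zero}  f = refl
sum-neg {suc n} f = trans (cong (ℚ.- f zero ℚ.+_) (sum-neg (f ∘ suc))) (sym (ℚP.neg-distrib-+ (f zero) _))

sum-single : ∀ {n} (f : Fin n → ℚ) i → (∀ j → j ≢ i → f j ≡ 0ℚ) → sum f ≡ f i
sum-single {suc n} f i f≡0 = begin
  sum f                                   ≡⟨ sum-remove {i = i} f ⟩
  f i ℚ.+ sum (f ∘ punchIn i)             ≡⟨ cong (f i ℚ.+_) (sum-cong-≗ {x = f ∘ punchIn i} {y = λ _ → 0ℚ}
                                                                 (λ j → f≡0 _ (FinP.punchInᵢ≢i i j))) ⟩
  f i ℚ.+ sum {n} (λ _ → 0ℚ)              ≡⟨ cong (f i ℚ.+_) (sum-replicate-zero n) ⟩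
  f i ℚ.+ 0ℚ                              ≡⟨ ℚP.+-identityʳ (f i) ⟩
  f i                                     ∎
  where open ≡-Reasoning

infix 7 _·_
_·_ : ∀ {d} → ℚ^ d → ℚ^ d → ℚ
c · w = sum (λ j → c j ℚ.* w j)

·-congʳ : ∀ {d} (c : ℚ^ d) {w w' : ℚ^ d} → (∀ j → w j ≡ w' j) → c · w ≡ c · w'
·-congʳ c w≗w' = sum-cong-≗ (λ j → cong (c j ℚ.*_) (w≗w' j))

·-scaleʳ : ∀ {d} (c : ℚ^ d) r (w : ℚ^ d) → c · (λ j → r ℚ.* w j) ≡ r ℚ.* (c · w)
·-scaleʳ c r w = trans (sum-cong-≗ (λ j → x∙yz≈y∙xz (c j) r (w j))) (sym (*-distribˡ-sum r (λ j → c j ℚ.* w j)))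

diff : ∀ {d} → ℤ^ d → ℤ^ d → ℚ^ d
diff p q j = toℚ (p j ℤ.- q j)

·-diff : ∀ {d} (c : ℚ^ d) p q → c · diff p q ≡ eval c p ℚ.- eval c q
·-diff c p q = begin
  c · diff p q                                              ≡⟨ sum-cong-≗ (λ j → distrib (c j) (p j) (q j)) ⟩
  sum (λ j → c j ℚ.* toℚ (p j) ℚ.+ ℚ.- (c j ℚ.* toℚ (q j)))  ≡⟨ ∑-distrib-+ cp (λ j → ℚ.- cq j) ⟩
  sum (cp) ℚ.+ sum (λ j → ℚ.- (c j ℚ.* toℚ (q j)))           ≡⟨ cong (sum cp ℚ.+_) (sum-neg cq) ⟩
  sum cp ℚ.- sum cq                                         ≡⟨ sym (cong₂ ℚ._-_ (sumℚ≡sum cp) (sumℚ≡sum cq)) ⟩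
  eval c p ℚ.- eval c q                                     ∎
  where
  open ≡-Reasoning
  cp cq : Fin _ → ℚ
  cp j = c j ℚ.* toℚ (p j)
  cq j = c j ℚ.* toℚ (q j)
  distrib : ∀ r a b → r ℚ.* toℚ (a ℤ.- b) ≡ r ℚ.* toℚ a ℚ.+ ℚ.- (r ℚ.* toℚ b)
  distrib r a b = trans (cong (r ℚ.*_) (toℚ-- a b))
    (trans (ℚP.*-distribˡ-+ r (toℚ a) _) (cong (r ℚ.* toℚ a ℚ.+_) (sym (ℚP.neg-distribʳ-* r (toℚ b)))))

toℚ-combℤ : ∀ {n d} (a : Fin n → ℤ) (u : Fin n → ℤ^ d) j →
  toℚ (combℤ a u j) ≡ sum (λ i → toℚ (a i) ℚ.* toℚ (u i j))
toℚ-combℤ a u j = trans (toℚ-sumℤ (λ i → a i ℤ.* u i j)) (sum-cong-≗ {x = λ i → toℚ (a i ℤ.* u i j)} (λ i → toℚ-* (a i) (u i j)))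

·-combℤ : ∀ {n d} (c : ℚ^ d) (a : Fin n → ℤ) (u : Fin n → ℤ^ d) →
  c · (toℚ ∘ combℤ a u) ≡ sum (λ i → toℚ (a i) ℚ.* (c · (toℚ ∘ u i)))
·-combℤ c a u = begin
  c · (toℚ ∘ combℤ a u)                                ≡⟨ ·-congʳ c (toℚ-combℤ a u) ⟩
  sum (λ j → c j ℚ.* sum (λ i → A i ℚ.* U i j))          ≡⟨ sum-cong-≗ (λ j → *-distribˡ-sum (c j) (λ i → A i ℚ.* U i j)) ⟩
  sum (λ j → sum (λ i → c j ℚ.* (A i ℚ.* U i j)))        ≡⟨ ∑-comm (λ j i → c j ℚ.* (A i ℚ.* U i j)) ⟩
  sum (λ i → sum (λ j → c j ℚ.* (A i ℚ.* U i j)))        ≡⟨ sum-cong-≗ (λ i → ·-scaleʳ c (A i) (U i)) ⟩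
  sum (λ i → A i ℚ.* (c · U i))                          ∎
  where
  open ≡-Reasoning
  A : Fin _ → ℚ
  A = toℚ ∘ a
  U : Fin _ → ℚ^ _
  U i = toℚ ∘ u i

module Exposed {d} (φ : Label d → ℤ^ d) (c : ℚ^ d) where

  MaxFace-·-diff : ∀ {p q} → MaxFace φ c p → MaxFace φ c q → c · diff (φ p) (φ q) ≡ 0ℚ
  MaxFace-·-diff {p} {q} p-max q-max =
    trans (·-diff c (φ p) (φ q)) (x≈y⇒x∙y⁻¹≈ε (ℚP.≤-antisym (q-max p) (p-max q)))

  ·-diff-MaxFace : ∀ {p q} → MaxFace φ c q → c · diff (φ p) (φ q) ≡ 0ℚ → MaxFace φ c p
  ·-diff-MaxFace {p} {q} q-max c·diff≡0 b =
    subst (eval c (φ b) ℚ.≤_) (sym (x∙y⁻¹≈ε⇒x≈y _ _ (trans (sym (·-diff c (φ p) (φ q))) c·diff≡0))) (q-max b)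

  MaxFace? : ∀ {v} → MaxFace φ c v → ∀ b → Dec (MaxFace φ c b)
  MaxFace? {v} v-max b =
    map′ (λ v≤b b' → ℚP.≤-trans (v-max b') v≤b) (λ b-max → b-max v) (eval c (φ v) ℚP.≤? eval c (φ b))

-- Spans of vertex differences

Supported : ∀ {d} → CubeFace d → List (Term d) → Set
Supported σ []                 = ⊤
Supported σ (term _ p m ∷ ts) = p ∈CF σ × m ∈CF σ × Supported σ ts

combination : ∀ {d} → (Label d → ℤ^ d) → List (Term d) → ℚ^ d
combination φ []                 j = 0ℚ
combination φ (term q p m ∷ ts) j = q ℚ.* diff (φ p) (φ m) j ℚ.+ combination φ ts j

Span : ∀ {d} → (Label d → ℤ^ d) → CubeFace d → ℚ^ d → Set
Span {d} φ σ w = Σ (List (Term d)) λ ts → Supported σ ts × (∀ j → w j ≡ combination φ ts j)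

module _ {d} (φ : Label d → ℤ^ d) (σ : CubeFace d) where

  -- The two auxiliary functions of InSpanDiffs are local to Defs; unification recovers them.
  private
    unfolded : Σ (ℚ^ d → List (Term d) → Set) λ Supp → Σ (ℚ^ d → List (Term d) → ℚ^ d) λ comb →
      ∀ w → InSpanDiffs φ σ w ≡ (Σ (List (Term d)) λ ts → Supp w ts × (∀ j → w j ≡ comb w ts j))
    unfolded = _ , _ , λ _ → refl

    Supp : ℚ^ d → List (Term d) → Set
    Supp = proj₁ unfolded
    comb : ℚ^ d → List (Term d) → ℚ^ d
    comb = proj₁ (proj₂ unfolded)

    Supp→Supported : ∀ w ts → Supp w ts → Supported σ ts
    Supp→Supported w []                 _                 = tt
    Supp→Supported w (term _ _ _ ∷ ts) (p∈ , m∈ , supp) = p∈ , m∈ , Supp→Supported w ts supp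

    Supported→Supp : ∀ w ts → Supported σ ts → Supp w ts
    Supported→Supp w []                 _                 = tt
    Supported→Supp w (term _ _ _ ∷ ts) (p∈ , m∈ , supp) = p∈ , m∈ , Supported→Supp w ts supp

    comb≡combination : ∀ w ts j → comb w ts j ≡ combination φ ts j
    comb≡combination w []                 j = refl
    comb≡combination w (term q p m ∷ ts) j = cong (q ℚ.* diff (φ p) (φ m) j ℚ.+_) (comb≡combination w ts j)

  InSpanDiffs→Span : ∀ {w} → InSpanDiffs φ σ w → Span φ σ w
  InSpanDiffs→Span {w} (ts , supp , w≗) =
    ts , Supp→Supported w ts supp , λ j → trans (w≗ j) (comb≡combination w ts j)

  Span→InSpanDiffs : ∀ {w} → Span φ σ w → InSpanDiffs φ σ w
  Span→InSpanDiffs {w} (ts , supp , w≗) =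
    ts , Supported→Supp w ts supp , λ j → trans (w≗ j) (sym (comb≡combination w ts j))

module _ {d} {φ : Label d → ℤ^ d} {σ : CubeFace d} where

  span-resp : ∀ {w w'} → (∀ j → w j ≡ w' j) → Span φ σ w → Span φ σ w'
  span-resp w≗w' (ts , supp , w≗) = ts , supp , λ j → trans (sym (w≗w' j)) (w≗ j)

  span-0 : Span φ σ (λ _ → 0ℚ)
  span-0 = [] , tt , λ _ → refl

  span-diff : ∀ {p m} → p ∈CF σ → m ∈CF σ → Span φ σ (diff (φ p) (φ m))
  span-diff {p} {m} p∈ m∈ =
    term ℚ.1ℚ p m ∷ [] , (p∈ , m∈ , tt) , λ j → sym (trans (ℚP.+-identityʳ _) (ℚP.*-identityˡ _))

  private
    Supported-++ : ∀ ts ts' → Supported σ ts → Supported σ ts' → Supported σ (ts ++ ts')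
    Supported-++ []                 ts' _                 supp' = supp'
    Supported-++ (term _ _ _ ∷ ts) ts' (p∈ , m∈ , supp) supp' = p∈ , m∈ , Supported-++ ts ts' supp supp'

    combination-++ : ∀ ts ts' j → combination φ (ts ++ ts') j ≡ combination φ ts j ℚ.+ combination φ ts' j
    combination-++ []                 ts' j = sym (ℚP.+-identityˡ _)
    combination-++ (term q p m ∷ ts) ts' j =
      trans (cong (q ℚ.* diff (φ p) (φ m) j ℚ.+_) (combination-++ ts ts' j))
        (sym (ℚP.+-assoc (q ℚ.* diff (φ p) (φ m) j) (combination φ ts j) (combination φ ts' j)))

    scale : ℚ → Term d → Term d
    scale r (term q p m) = term (r ℚ.* q) p m

    Supported-map : ∀ r ts → Supported σ ts → Supported σ (map (scale r) ts)
    Supported-map r []                 _                 = tt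
    Supported-map r (term _ _ _ ∷ ts) (p∈ , m∈ , supp) = p∈ , m∈ , Supported-map r ts supp

    combination-map : ∀ r ts j → combination φ (map (scale r) ts) j ≡ r ℚ.* combination φ ts j
    combination-map r []                 j = sym (ℚP.*-zeroʳ r)
    combination-map r (term q p m ∷ ts) j = begin
      r ℚ.* q ℚ.* x ℚ.+ combination φ (map (scale r) ts) j  ≡⟨ cong₂ ℚ._+_ (ℚP.*-assoc r q x) (combination-map r ts j) ⟩
      r ℚ.* (q ℚ.* x) ℚ.+ r ℚ.* combination φ ts j          ≡⟨ sym (ℚP.*-distribˡ-+ r _ _) ⟩
      r ℚ.* (q ℚ.* x ℚ.+ combination φ ts j)                ∎
      where
      open ≡-Reasoning
      x = diff (φ p) (φ m) j

  span-+ : ∀ {w w'} → Span φ σ w → Span φ σ w' → Span φ σ (λ j → w j ℚ.+ w' j)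
  span-+ (ts , supp , w≗) (ts' , supp' , w'≗) =
    ts ++ ts' , Supported-++ ts ts' supp supp' ,
    λ j → trans (cong₂ ℚ._+_ (w≗ j) (w'≗ j)) (sym (combination-++ ts ts' j))

  span-* : ∀ {w} r → Span φ σ w → Span φ σ (λ j → r ℚ.* w j)
  span-* r (ts , supp , w≗) =
    map (scale r) ts , Supported-map r ts supp , λ j → trans (cong (r ℚ.*_) (w≗ j)) (sym (combination-map r ts j))

  span-sum : ∀ {n} (f : Fin n → ℚ^ d) → (∀ i → Span φ σ (f i)) → Span φ σ (λ j → sum (λ i → f i j))
  span-sum {zero}  f f-span = span-0
  span-sum {suc n} f f-span = span-+ (f-span zero) (span-sum (f ∘ suc) (f-span ∘ suc))

span-mono : ∀ {d} {φ : Label d → ℤ^ d} {σ τ : CubeFace d} →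
  (∀ {p m} → p ∈CF σ → m ∈CF σ → Span φ τ (diff (φ p) (φ m))) → ∀ {w} → Span φ σ w → Span φ τ w
span-mono {φ = φ} {σ} {τ} σ⊆τ (ts , supp , w≗) = span-resp (λ j → sym (w≗ j)) (spans ts supp)
  where
  spans : ∀ ts → Supported σ ts → Span φ τ (combination φ ts)
  spans []                 _                 = span-0
  spans (term q p m ∷ ts) (p∈ , m∈ , supp) = span-+ (span-* q (σ⊆τ p∈ m∈)) (spans ts supp)

module _ {d} {b : Label d} where

  ∈face0 : ∀ {z} → b ∈CF face0 z ⇔ b z ≡ false
  ∈face0 {z} = mk⇔ (λ b∈ → b∈ z at-z) intro
    where
    at-z : face0 z z ≡ just false
    at-z with z ≟ z
    ... | yes _   = refl
    ... | no z≢z = contradiction refl z≢z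
    intro : b z ≡ false → b ∈CF face0 z
    intro bz k eq with k ≟ z
    intro bz k refl | yes refl = bz
    intro bz k ()   | no _

  ∈face1 : ∀ {z} → b ∈CF face1 z ⇔ b z ≡ true
  ∈face1 {z} = mk⇔ (λ b∈ → b∈ z at-z) intro
    where
    at-z : face1 z z ≡ just true
    at-z with z ≟ z
    ... | yes _   = refl
    ... | no z≢z = contradiction refl z≢z
    intro : b z ≡ true → b ∈CF face1 z
    intro bz k eq with k ≟ z
    intro bz k refl | yes refl = bz
    intro bz k ()   | no _

  ∈face0v : ∀ {x z s} → x ≢ z → b ∈CF face0v x z s ⇔ (b z ≡ s × b x ≡ false)
  ∈face0v {x} {z} {s} x≢z = mk⇔ (λ b∈ → b∈ z at-z , b∈ x at-x) intro
    where
    at-z : face0v x z s z ≡ just s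
    at-z with z ≟ z
    ... | yes _   = refl
    ... | no z≢z = contradiction refl z≢z
    at-x : face0v x z s x ≡ just false
    at-x with x ≟ z
    ... | yes x≡z = contradiction x≡z x≢z
    ... | no _ with x ≟ x
    ...   | yes _   = refl
    ...   | no x≢x = contradiction refl x≢x
    intro : b z ≡ s × b x ≡ false → b ∈CF face0v x z s
    intro (bz , bx) k eq with k ≟ z
    intro (bz , bx) k refl | yes refl = bz
    intro (bz , bx) k eq   | no _ with k ≟ x
    intro (bz , bx) k refl | no _ | yes refl = bx
    intro (bz , bx) k ()   | no _ | no _

facet : ∀ {d} → Fin d → Bool → CubeFace d
facet z false = face0 z
facet z true  = face1 z

∈facet : ∀ {d} {b : Label d} {z} s → b ∈CF facet z s ⇔ b z ≡ s
∈facet false = ∈face0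
∈facet true  = ∈face1

-- Smooth vertices

AtMostOneEdgeLeaves : ∀ {d} → (Label d → ℤ^ d) → ℚ^ d → Label d → Set
AtMostOneEdgeLeaves φ c v = ∀ b₁ b₂ → Edge φ v b₁ → Edge φ v b₂ →
  ¬ MaxFace φ c b₁ → ¬ MaxFace φ c b₂ → ∀ k → b₁ k ≡ b₂ k

module SmoothVertex {d} {φ : Label d → ℤ^ d} {c : ℚ^ d} {v : Label d}
  (v-max : MaxFace φ c v) (one-leaves : AtMostOneEdgeLeaves φ c v)
  (e : Fin d → Label d) (e-inj : ∀ i j → (∀ k → e i k ≡ e j k) → i ≡ j) (e-edge : ∀ i → Edge φ v (e i))
  (u : Fin d → ℤ^ d) (u-prim : ∀ i → PrimitiveDir (φ (e i) -ᵥ φ v) (u i)) where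

  open Exposed φ c

  U : Fin d → ℚ^ d
  U i = toℚ ∘ u i

  len-pred : Fin d → ℕ
  len-pred i = proj₁ (proj₁ (u-prim i))

  len : Fin d → ℚ
  len i = toℚ (+ suc (len-pred i))

  len≢0 : ∀ i → len i ≢ 0ℚ
  len≢0 i = toℚ-suc≢0 (len-pred i)

  diff-edge : ∀ i j → diff (φ (e i)) (φ v) j ≡ len i ℚ.* U i j
  diff-edge i j = trans (cong toℚ (proj₂ (proj₁ (u-prim i)) j)) (toℚ-* (+ suc (len-pred i)) (u i j))

  ·-diff-edge : ∀ i → c · diff (φ (e i)) (φ v) ≡ len i ℚ.* (c · U i)
  ·-diff-edge i = trans (·-congʳ c (diff-edge i)) (·-scaleʳ c (len i) (U i))

  ·-staying : ∀ i → MaxFace φ c (e i) → c · U i ≡ 0ℚ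
  ·-staying i e-max = x*y≡0⇒y≡0 (len≢0 i) (trans (sym (·-diff-edge i)) (MaxFace-·-diff e-max v-max))

  ·-leaving : ∀ i → ¬ MaxFace φ c (e i) → c · U i ≢ 0ℚ
  ·-leaving i ¬max c·U≡0 =
    ¬max (·-diff-MaxFace v-max (trans (·-diff-edge i) (trans (cong (len i ℚ.*_) c·U≡0) (ℚP.*-zeroʳ (len i)))))

  -- Pairing with c kills every term of the expansion of φ b − φ v except the leaving one.
  leaving-coefficient≡0 : ∀ {b} (a : Fin d → ℤ) → (∀ j → combℤ a u j ≡ (φ b -ᵥ φ v) j) → MaxFace φ c b →
    ∀ i → ¬ MaxFace φ c (e i) → toℚ (a i) ≡ 0ℚ
  leaving-coefficient≡0 {b} a a-rep b-max i ¬max =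
    x*y≡0⇒y≡0 (·-leaving i ¬max) (trans (ℚP.*-comm (c · U i) (toℚ (a i))) (begin
      toℚ (a i) ℚ.* (c · U i)                   ≡⟨ sum-single (λ i' → toℚ (a i') ℚ.* (c · U i')) i others ⟨
      sum (λ i' → toℚ (a i') ℚ.* (c · U i'))    ≡⟨ ·-combℤ c a u ⟨
      c · (toℚ ∘ combℤ a u)                     ≡⟨ ·-congʳ c (cong toℚ ∘ a-rep) ⟩
      c · diff (φ b) (φ v)                      ≡⟨ MaxFace-·-diff b-max v-max ⟩
      0ℚ                                        ∎))
    where
    open ≡-Reasoning
    others : ∀ i' → i' ≢ i → toℚ (a i') ℚ.* (c · U i') ≡ 0ℚ
    others i' i'≢i with MaxFace? v-max (e i')
    ... | yes e-max = trans (cong (toℚ (a i') ℚ.*_) (·-staying i' e-max)) (ℚP.*-zeroʳ (toℚ (a i')))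
    ... | no ¬max'  = contradiction (e-inj i' i (one-leaves (e i') (e i) (e-edge i') (e-edge i) ¬max' ¬max)) i'≢i

  span-expansion : ∀ {τ} → (∀ i → MaxFace φ c (e i) → Span φ τ (diff (φ (e i)) (φ v))) →
    ∀ {b} → MaxFace φ c b → (Σ (Fin d → ℤ) λ a → ∀ j → combℤ a u j ≡ (φ b -ᵥ φ v) j) →
    Span φ τ (diff (φ b) (φ v))
  span-expansion {τ} edge-span {b} b-max (a , a-rep) =
    span-resp (λ j → trans (sym (toℚ-combℤ a u j)) (cong toℚ (a-rep j))) (span-sum _ term-span)
    where
    term-span : ∀ i → Span φ τ (λ j → toℚ (a i) ℚ.* U i j)
    term-span i with MaxFace? v-max (e i)
    ... | yes e-max = span-resp (λ j → trans (cong (r ℚ.*_) (diff-edge i j)) (*-1/-cancel (toℚ (a i)) (len i) (U i j)))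
                                (span-* r (edge-span i e-max))
      where
      instance
        len-nonZero : ℚ.NonZero (len i)
        len-nonZero = ℚ.≢-nonZero (len≢0 i)
      r : ℚ
      r = toℚ (a i) ℚ.* ℚ.1/ len i
    ... | no ¬max = span-resp (λ j → trans (sym (ℚP.*-zeroˡ (U i j)))
                                      (cong (ℚ._* U i j) (sym (leaving-coefficient≡0 a a-rep b-max i ¬max))))
                              span-0

span-face-diff : ∀ {d} {φ : Label d → ℤ^ d} {c : ℚ^ d} {τ : CubeFace d} {v : Label d} →
  IsSmooth φ → MaxFace φ c v → AtMostOneEdgeLeaves φ c v →
  (∀ b → Edge φ v b → MaxFace φ c b → Span φ τ (diff (φ b) (φ v))) →
  ∀ b → MaxFace φ c b → Span φ τ (diff (φ b) (φ v))
span-face-diff {φ = φ} {c} {v = v} smooth v-max one-leaves edge-span b b-max with smooth v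
... | e , e-inj , e-edge , _ , u , u-prim , u-spans , _ =
  SmoothVertex.span-expansion {φ = φ} {c} {v} v-max one-leaves e e-inj e-edge u u-prim
    (λ i → edge-span (e i) (e-edge i)) b-max (u-spans (φ b -ᵥ φ v))

-- Edges and facets of a combinatorial cube

module _ {d} {φ : Label d → ℤ^ d} (cube : IsCombinatorialCube φ) where

  -- Flipping coordinate k of v gives a vertex of every face containing v and b, so it is v or b.
  edge-flips-one : ∀ v b k → Edge φ v b → b k ≢ v k → ∀ k' → k' ≢ k → b k' ≡ v k'
  edge-flips-one v b k (_ , c , max⇔) bk≢vk k' k'≢k =
    [ flipped≡v⇒ , flipped≡b⇒ ]′ (to (max⇔ flipped) (to (exposes flipped) flipped∈σ))
    where
    σ : CubeFace d
    σ = proj₁ (proj₂ (proj₂ cube) c)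
    exposes : Exposes φ c σ
    exposes = proj₂ (proj₂ (proj₂ cube) c)
    v∈σ : v ∈CF σ
    v∈σ = from (exposes v) (from (max⇔ v) (inj₁ (λ _ → refl)))
    b∈σ : b ∈CF σ
    b∈σ = from (exposes b) (from (max⇔ b) (inj₂ (λ _ → refl)))
    flipped : Label d
    flipped = updateAt v k not
    flipped∈σ : flipped ∈CF σ
    flipped∈σ i σi≡w with i ≟ k
    ... | yes refl = contradiction (trans (b∈σ i σi≡w) (sym (v∈σ i σi≡w))) bk≢vk
    ... | no i≢k  = trans (updateAt-minimal i k v i≢k) (v∈σ i σi≡w)
    flipped≡v⇒ : (∀ i → flipped i ≡ v i) → b k' ≡ v k'
    flipped≡v⇒ flipped≡v = contradiction (trans (sym (flipped≡v k)) (updateAt-updates k v)) (not-¬ refl)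
    flipped≡b⇒ : (∀ i → flipped i ≡ b i) → b k' ≡ v k'
    flipped≡b⇒ flipped≡b = trans (sym (flipped≡b k')) (updateAt-minimal k' k v k'≢k)

  edge-fixes-x-or-y : ∀ {x y} → x ≢ y → ∀ v b → Edge φ v b → b x ≡ v x ⊎ b y ≡ v y
  edge-fixes-x-or-y {x} {y} x≢y v b edge with b x ≟ᵇ v x
  ... | yes bx≡vx = inj₁ bx≡vx
  ... | no bx≢vx  = inj₂ (edge-flips-one v b x edge bx≢vx y (x≢y ∘ sym))

  facet-one-edge-leaves : ∀ c z s v → Exposes φ c (facet z s) → v z ≡ s → AtMostOneEdgeLeaves φ c v
  facet-one-edge-leaves c z s v exposes vz b₁ b₂ edge₁ edge₂ ¬max₁ ¬max₂ = agree
    where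
    leaves : ∀ {b} → ¬ MaxFace φ c b → b z ≢ s
    leaves {b} ¬max bz = ¬max (to (exposes b) (from (∈facet s) bz))
    flips : ∀ {b} → ¬ MaxFace φ c b → b z ≢ v z
    flips ¬max bz≡vz = leaves ¬max (trans bz≡vz vz)
    agree : ∀ k → b₁ k ≡ b₂ k
    agree k with k ≟ z
    ... | yes refl = trans (¬-not (leaves ¬max₁)) (sym (¬-not (leaves ¬max₂)))
    ... | no k≢z   = trans (edge-flips-one v b₁ z edge₁ (flips ¬max₁) k k≢z)
                           (sym (edge-flips-one v b₂ z edge₂ (flips ¬max₂) k k≢z))

-- lin(aff σ) ⊆ lin(aff τ); Parallel φ σ τ is this inclusion in both directions.
DirectionsWithin : ∀ {d} → (Label d → ℤ^ d) → CubeFace d → CubeFace d → Set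
DirectionsWithin φ σ τ = ∀ b b' → b ∈CF σ → b' ∈CF σ → InSpanDiffs φ τ (diff (φ b) (φ b'))

diff-via : ∀ {d} (p q r : ℤ^ d) j → diff p q j ≡ diff p r j ℚ.- diff q r j
diff-via p q r j = trans (cong toℚ (identity (p j) (q j) (r j))) (toℚ-- (p j ℤ.- r j) (q j ℤ.- r j))
  where
  identity : ∀ a b c → a ℤ.- b ≡ (a ℤ.- c) ℤ.- (b ℤ.- c)
  identity = solve-∀

span-− : ∀ {d} {φ : Label d → ℤ^ d} {σ} {w w' : ℚ^ d} →
  Span φ σ w → Span φ σ w' → Span φ σ (λ j → w j ℚ.- w' j)
span-− {w = w} {w'} w-span w'-span =
  span-resp (λ j → cong (w j ℚ.+_) (-1*x≈-x (w' j))) (span-+ w-span (span-* (ℚ.- ℚ.1ℚ) w'-span))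

module _ {d} {φ : Label d → ℤ^ d} (cube : IsCombinatorialCube φ) (smooth : IsSmooth φ)
         {x y z : Fin d} (x≢y : x ≢ y) (x≢z : x ≢ z) (y≢z : y ≢ z) where

  facet-directions : ∀ s →
    DirectionsWithin φ (face0v x z s) (face0v x z (not s)) →
    DirectionsWithin φ (face0v y z s) (face0v y z (not s)) →
    DirectionsWithin φ (facet z s) (facet z (not s))
  facet-directions s x-dirs y-dirs b b' b∈ b'∈ =
    Span→InSpanDiffs φ _ (span-resp (λ j → sym (diff-via (φ b) (φ b') (φ v) j))
                                    (span-− (to-corner b b∈) (to-corner b' b'∈)))
    where
    v : Label d
    v = updateAt (λ _ → false) z (λ _ → s)
    v-z : v z ≡ s
    v-z = updateAt-updates z (λ _ → false)
    v-off : ∀ {w} → w ≢ z → v w ≡ false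
    v-off {w} w≢z = updateAt-minimal w z (λ _ → false) w≢z

    c : ℚ^ d
    c = proj₁ (proj₁ (proj₂ cube) (facet z s))
    exposes : Exposes φ c (facet z s)
    exposes = proj₂ (proj₁ (proj₂ cube) (facet z s))

    through-ridge : ∀ {w} → w ≢ z → DirectionsWithin φ (face0v w z s) (face0v w z (not s)) →
      ∀ {b} → b z ≡ s → b w ≡ v w → Span φ (facet z (not s)) (diff (φ b) (φ v))
    through-ridge {w} w≢z w-dirs {b} bz bw≡vw =
      span-mono ridge⊆facet
        (InSpanDiffs→Span φ _ (w-dirs b v (from (∈face0v w≢z) (bz , trans bw≡vw (v-off w≢z)))
                                           (from (∈face0v w≢z) (v-z , v-off w≢z))))
      where
      in-facet : ∀ {p} → p ∈CF face0v w z (not s) → p ∈CF facet z (not s)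
      in-facet p∈ = from (∈facet (not s)) (proj₁ (to (∈face0v w≢z) p∈))
      ridge⊆facet : ∀ {p m} → p ∈CF face0v w z (not s) → m ∈CF face0v w z (not s) →
        Span φ (facet z (not s)) (diff (φ p) (φ m))
      ridge⊆facet p∈ m∈ = span-diff (in-facet p∈) (in-facet m∈)

    edge-in-facet : ∀ b → Edge φ v b → MaxFace φ c b → Span φ (facet z (not s)) (diff (φ b) (φ v))
    edge-in-facet b edge b-max =
      [ through-ridge x≢z x-dirs bz , through-ridge y≢z y-dirs bz ]′ (edge-fixes-x-or-y cube x≢y v b edge)
      where
      bz : b z ≡ s
      bz = to (∈facet s) (from (exposes b) b-max)

    to-corner : ∀ b → b ∈CF facet z s → Span φ (facet z (not s)) (diff (φ b) (φ v))
    to-corner b b∈ =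
      span-face-diff {c = c} smooth (to (exposes v) (from (∈facet s) v-z))
        (facet-one-edge-leaves cube c z s v exposes v-z) edge-in-facet b (to (exposes b) b∈)

corollary3p2 : (d : ℕ) → d ≥ 3 → (φ : Label d → ℤ^ d) →
    IsCombinatorialCube φ → IsSmooth φ →
    (x y z : Fin d) → x ≢ y → x ≢ z → y ≢ z →
    Parallel φ (face00 x z) (face01 x z) →
    Parallel φ (face00 y z) (face01 y z) →
    Parallel φ (face0 z) (face1 z)
-- d ≥ 3 is implied by x, y, z being distinct.
corollary3p2 d _ φ cube smooth x y z x≢y x≢z y≢z (x-dirs₀ , x-dirs₁) (y-dirs₀ , y-dirs₁) =
  facet-directions cube smooth x≢y x≢z y≢z false x-dirs₀ y-dirs₀ ,
  facet-directions cube smooth x≢y x≢z y≢z true  x-dirs₁ y-dirs₁
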